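{- Let $P,Q$ be posets. An open down-set $\mathcal{I}$ of $\mathrm{Pro}(P,Q)$ is regular if and only if $\overline{\mathcal{I}}\setminus\mathcal{I}$ contains no large profunctor. Similarly, an open up-set $\mathcal{F}$ is regular if and only if $\overline{\mathcal{F}}\setminus\mathcal{F}$ contains no small profunctor.
   Context: $\widehat{Q}$ is the set of down-sets of $Q$ ordered by inclusion. A profunctor $f:P\to Q$ is an order-preserving map $f:P\to\widehat{Q}$; $\mathrm{Pro}(P,Q)$ is ordered pointwise by inclusion. $f$ is large if $\{p: f(p)\neq Q\}$ is finite, small if $\bigcup_p f(p)$ is finite. The topology on $\mathrm{Pro}(P,Q)$ has as basis the sets $U(g,h)=\{f: g\le f\le h\}$ with $g$ small and $h$ large. An open set is regular if it equals the interior of its closure; $\overline{X}$ denotes closure. -}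

module Defs where

open import Level using (0ℓ) renaming (suc to lsuc)
open import Data.Product using (Σ; _×_; _,_; ∃)
open import Data.List using (List)
open import Data.List.Relation.Unary.Any using (Any)
open import Relation.Nullary using (¬_)
open import Relation.Binary.Bundles using (Poset)

module ProDefs (P Q : Poset 0ℓ 0ℓ 0ℓ) where
  private
    module P = Poset P
    module Q = Poset Q

  record DownSet : Set₁ where
    field
      mem    : Q.Carrier → Set
      down   : ∀ {x y} → y Q.≤ x → mem x → mem y
  open DownSet public

  _⊆ᴰ_ : DownSet → DownSet → Set
  A ⊆ᴰ B = ∀ q → mem A q → mem B q

  record Pro : Set₁ where
    field
      app  : P.Carrier → DownSet
      mono : ∀ {p p'} → p P.≤ p' → app p ⊆ᴰ app p'
  open Pro public

  _≤ᴾ_ : Pro → Pro → Set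
  g ≤ᴾ f = ∀ p → app g p ⊆ᴰ app f p

  FiniteP : (P.Carrier → Set) → Set
  FiniteP S = Σ (List P.Carrier) λ L → ∀ p → S p → Any (p P.≈_) L

  FiniteQ : (Q.Carrier → Set) → Set
  FiniteQ S = Σ (List Q.Carrier) λ L → ∀ q → S q → Any (q Q.≈_) L

  IsTop : DownSet → Set
  IsTop A = ∀ q → mem A q

  Large : Pro → Set
  Large f = FiniteP (λ p → ¬ IsTop (app f p))

  Small : Pro → Set
  Small f = FiniteQ (λ q → ∃ λ p → mem (app f p) q)

  Subset : Set₂
  Subset = Pro → Set₁

  U : Pro → Pro → Subset
  U g h f = Lift' (g ≤ᴾ f × f ≤ᴾ h)
    where
      open import Level using (Lift)
      Lift' : Set → Set₁
      Lift' A = Lift (lsuc 0ℓ) A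

  _⊆_ : Subset → Subset → Set₁
  X ⊆ Y = ∀ f → X f → Y f

  Interior : Subset → Subset
  Interior X f = Σ Pro λ g → Σ Pro λ h → Small g × Large h × U g h f × (U g h ⊆ X)

  IsOpen : Subset → Set₁
  IsOpen X = X ⊆ Interior X

  Closure : Subset → Subset
  Closure X f = ∀ g h → Small g → Large h → U g h f → Σ Pro λ f' → U g h f' × X f'

  IsRegular : Subset → Set₁
  IsRegular X = (X ⊆ Interior (Closure X)) × (Interior (Closure X) ⊆ X)

  IsDownSetᴾ : Subset → Set₁
  IsDownSetᴾ X = ∀ f g → g ≤ᴾ f → X f → X g

  IsUpSetᴾ : Subset → Set₁
  IsUpSetᴾ X = ∀ f g → f ≤ᴾ g → X f → X g

{-# OPTIONS --safe #-}
-- A basic open U(g,h) lies in the closure of a down-set I as soon as its upper end h does,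
-- because the closure of a down-set is again a down-set; so Int(Cl I) ⊆ I amounts to every
-- large h ∈ Cl I lying in I (h being large, U(⊥,h) is a neighbourhood of h inside Cl I).
-- Dually for up-sets, with the lower end g, which is small.
module Submission where

open import Defs
open import Level using (0ℓ; lift)
open import Data.Product using (_×_; _,_; proj₁; proj₂)
open import Data.Sum using (_⊎_; inj₁; inj₂)
open import Data.Empty using (⊥; ⊥-elim)
open import Data.Unit using (⊤; tt)
open import Data.List using ([])
open import Function using (_∘_)
open import Function.Bundles using (_⇔_; mk⇔; Equivalence)
open import Relation.Nullary using (¬_)
open import Relation.Binary.Bundles using (Poset)
open import Axiom.ExcludedMiddle using (ExcludedMiddle)
open import Axiom.DoubleNegationElimination using (DoubleNegationElimination; em⇒dne)

module ProLattice (P Q : Poset 0ℓ 0ℓ 0ℓ) where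
  open ProDefs P Q

  ⊥ᴾ : Pro
  ⊥ᴾ = record
    { app  = λ _ → record { mem = λ _ → ⊥ ; down = λ _ () }
    ; mono = λ _ _ () }

  ⊤ᴾ : Pro
  ⊤ᴾ = record
    { app  = λ _ → record { mem = λ _ → ⊤ ; down = λ _ _ → tt }
    ; mono = λ _ _ _ → tt }

  infixr 22 _∧ᴾ_
  infixr 21 _∨ᴾ_

  _∧ᴾ_ : Pro → Pro → Pro
  f ∧ᴾ g = record
    { app  = λ p → record
        { mem  = λ q → mem (app f p) q × mem (app g p) q
        ; down = λ y≤x (a , b) → down (app f p) y≤x a , down (app g p) y≤x b }
    ; mono = λ p≤p' q (a , b) → mono f p≤p' q a , mono g p≤p' q b }

  _∨ᴾ_ : Pro → Pro → Pro
  f ∨ᴾ g = record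
    { app  = λ p → record
        { mem  = λ q → mem (app f p) q ⊎ mem (app g p) q
        ; down = λ { y≤x (inj₁ a) → inj₁ (down (app f p) y≤x a)
                   ; y≤x (inj₂ b) → inj₂ (down (app g p) y≤x b) } }
    ; mono = λ { p≤p' q (inj₁ a) → inj₁ (mono f p≤p' q a)
               ; p≤p' q (inj₂ b) → inj₂ (mono g p≤p' q b) } }

  ≤ᴾ-refl : ∀ f → f ≤ᴾ f
  ≤ᴾ-refl _ _ _ x = x

  ≤ᴾ-trans : ∀ f g h → f ≤ᴾ g → g ≤ᴾ h → f ≤ᴾ h
  ≤ᴾ-trans _ _ _ f≤g g≤h p q x = g≤h p q (f≤g p q x)

  ⊥ᴾ-least : ∀ f → ⊥ᴾ ≤ᴾ f
  ⊥ᴾ-least _ _ _ ()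

  ⊤ᴾ-greatest : ∀ f → f ≤ᴾ ⊤ᴾ
  ⊤ᴾ-greatest _ _ _ _ = tt

  ∧ᴾ-glb : ∀ h f g → h ≤ᴾ f → h ≤ᴾ g → h ≤ᴾ f ∧ᴾ g
  ∧ᴾ-glb _ _ _ h≤f h≤g p q x = h≤f p q x , h≤g p q x

  ∧ᴾ-lowerˡ : ∀ f g → f ∧ᴾ g ≤ᴾ f
  ∧ᴾ-lowerˡ _ _ _ _ = proj₁

  ∧ᴾ-lowerʳ : ∀ f g → f ∧ᴾ g ≤ᴾ g
  ∧ᴾ-lowerʳ _ _ _ _ = proj₂

  ∨ᴾ-lub : ∀ f g h → f ≤ᴾ h → g ≤ᴾ h → f ∨ᴾ g ≤ᴾ h
  ∨ᴾ-lub _ _ _ f≤h _   p q (inj₁ x) = f≤h p q x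
  ∨ᴾ-lub _ _ _ _   g≤h p q (inj₂ y) = g≤h p q y

  ∨ᴾ-upperˡ : ∀ f g → f ≤ᴾ f ∨ᴾ g
  ∨ᴾ-upperˡ _ _ _ _ = inj₁

  ∨ᴾ-upperʳ : ∀ f g → g ≤ᴾ f ∨ᴾ g
  ∨ᴾ-upperʳ _ _ _ _ = inj₂

  ⊥ᴾ-small : Small ⊥ᴾ
  ⊥ᴾ-small = [] , λ { _ (_ , ()) }

  ⊤ᴾ-large : Large ⊤ᴾ
  ⊤ᴾ-large = [] , λ _ ¬top → ⊥-elim (¬top (λ _ → tt))

  ∧ᴾ-smallˡ : ∀ g f → Small g → Small (g ∧ᴾ f)
  ∧ᴾ-smallˡ _ _ (L , cover) = L , λ { q (p , x , _) → cover q (p , x) }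

  ∨ᴾ-largeˡ : ∀ h f → Large h → Large (h ∨ᴾ f)
  ∨ᴾ-largeˡ _ _ (L , cover) = L , λ p ¬top → cover p (λ ht → ¬top (λ q → inj₁ (ht q)))

module ProTopology (P Q : Poset 0ℓ 0ℓ 0ℓ) where
  open ProDefs P Q
  open ProLattice P Q

  U-lower : ∀ g h f → U g h f → U g h g
  U-lower g h f (lift (g≤f , f≤h)) = lift (≤ᴾ-refl g , ≤ᴾ-trans g f h g≤f f≤h)

  U-upper : ∀ g h f → U g h f → U g h h
  U-upper g h f (lift (g≤f , f≤h)) = lift (≤ᴾ-trans g f h g≤f f≤h , ≤ᴾ-refl h)

  ⊆-closure : ∀ X → X ⊆ Closure X
  ⊆-closure X f Xf _ _ _ _ f∈U = f , f∈U , Xf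

  open⇒⊆interior-closure : ∀ X → IsOpen X → X ⊆ Interior (Closure X)
  open⇒⊆interior-closure X open-X f Xf with open-X f Xf
  ... | g , h , small-g , large-h , f∈U , U⊆X =
    g , h , small-g , large-h , f∈U , λ f' → ⊆-closure X f' ∘ U⊆X f'

  -- For f' ≤ f the neighbourhood U(g,h) of f' is widened to U(g, h ∨ f) ∋ f; a witness f''
  -- found there is cut back into U(g,h) by meeting it with h.
  closure-down : ∀ I → IsDownSetᴾ I → IsDownSetᴾ (Closure I)
  closure-down I down-I f f' f'≤f f∈Cl g h small-g large-h (lift (g≤f' , f'≤h))
    with f∈Cl g (h ∨ᴾ f) small-g (∨ᴾ-largeˡ h f large-h)
           (lift (≤ᴾ-trans g f' f g≤f' f'≤f , ∨ᴾ-upperʳ h f))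
  ... | f'' , lift (g≤f'' , _) , If'' =
    f'' ∧ᴾ h , lift (∧ᴾ-glb g f'' h g≤f'' (≤ᴾ-trans g f' h g≤f' f'≤h) , ∧ᴾ-lowerʳ f'' h) ,
    down-I f'' (f'' ∧ᴾ h) (∧ᴾ-lowerˡ f'' h) If''

  closure-up : ∀ F → IsUpSetᴾ F → IsUpSetᴾ (Closure F)
  closure-up F up-F f f' f≤f' f∈Cl g h small-g large-h (lift (g≤f' , f'≤h))
    with f∈Cl (g ∧ᴾ f) h (∧ᴾ-smallˡ g f small-g) large-h
           (lift (∧ᴾ-lowerʳ g f , ≤ᴾ-trans f f' h f≤f' f'≤h))
  ... | f'' , lift (_ , f''≤h) , Ff'' =
    f'' ∨ᴾ g , lift (∨ᴾ-upperʳ f'' g , ∨ᴾ-lub f'' g h f''≤h (≤ᴾ-trans g f' h g≤f' f'≤h)) ,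
    up-F f'' (f'' ∨ᴾ g) (∨ᴾ-upperˡ f'' g) Ff''

  large-closure⇒interior-closure : ∀ I → IsDownSetᴾ I →
    ∀ h → Large h → Closure I h → Interior (Closure I) h
  large-closure⇒interior-closure I down-I h large-h h∈Cl =
    ⊥ᴾ , h , ⊥ᴾ-small , large-h , lift (⊥ᴾ-least h , ≤ᴾ-refl h) ,
    λ { f (lift (_ , f≤h)) → closure-down I down-I h f f≤h h∈Cl }

  small-closure⇒interior-closure : ∀ F → IsUpSetᴾ F →
    ∀ g → Small g → Closure F g → Interior (Closure F) g
  small-closure⇒interior-closure F up-F g small-g g∈Cl =
    g , ⊤ᴾ , small-g , ⊤ᴾ-large , lift (≤ᴾ-refl g , ⊤ᴾ-greatest g) ,
    λ { f (lift (g≤f , _)) → closure-up F up-F g f g≤f g∈Cl }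

  down-set-regular⇔ : ∀ I → IsOpen I → IsDownSetᴾ I →
    IsRegular I ⇔ (∀ h → Large h → Closure I h → I h)
  down-set-regular⇔ I open-I down-I = mk⇔
    (λ (_ , int-cl⊆I) h large-h h∈Cl →
       int-cl⊆I h (large-closure⇒interior-closure I down-I h large-h h∈Cl))
    (λ large-cl⊆I → open⇒⊆interior-closure I open-I ,
       λ { f (g , h , _ , large-h , f∈U@(lift (_ , f≤h)) , U⊆Cl) →
             down-I h f f≤h (large-cl⊆I h large-h (U⊆Cl h (U-upper g h f f∈U))) })

  up-set-regular⇔ : ∀ F → IsOpen F → IsUpSetᴾ F →
    IsRegular F ⇔ (∀ g → Small g → Closure F g → F g)
  up-set-regular⇔ F open-F up-F = mk⇔
    (λ (_ , int-cl⊆F) g small-g g∈Cl →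
       int-cl⊆F g (small-closure⇒interior-closure F up-F g small-g g∈Cl))
    (λ small-cl⊆F → open⇒⊆interior-closure F open-F ,
       λ { f (g , h , small-g , _ , f∈U@(lift (g≤f , _)) , U⊆Cl) →
             up-F g f g≤f (small-cl⊆F g small-g (U⊆Cl g (U-lower g h f f∈U))) })

lemma5p7 : ExcludedMiddle (Level.suc 0ℓ) → (P Q : Poset 0ℓ 0ℓ 0ℓ) →
    let open ProDefs P Q in
    (∀ (I : Subset) → IsOpen I → IsDownSetᴾ I →
      (IsRegular I ⇔ (∀ f → Closure I f → ¬ I f → ¬ Large f)))
    ×
    (∀ (F : Subset) → IsOpen F → IsUpSetᴾ F →
      (IsRegular F ⇔ (∀ f → Closure F f → ¬ F f → ¬ Small f)))
lemma5p7 em P Q =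
  (λ I open-I down-I → let open Equivalence (down-set-regular⇔ I open-I down-I) in mk⇔
     (λ reg f f∈Cl ¬If large-f → ¬If (to reg f large-f f∈Cl))
     (λ H → from λ h large-h h∈Cl → dne λ ¬Ih → H h h∈Cl ¬Ih large-h)) ,
  (λ F open-F up-F → let open Equivalence (up-set-regular⇔ F open-F up-F) in mk⇔
     (λ reg f f∈Cl ¬Ff small-f → ¬Ff (to reg f small-f f∈Cl))
     (λ H → from λ g small-g g∈Cl → dne λ ¬Fg → H g g∈Cl ¬Fg small-g))
  where
    open ProTopology P Q
    dne : DoubleNegationElimination (Level.suc 0ℓ)
    dne = em⇒dne em
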